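{- If $n$ is even, then \[ p(n) = \sum_{i\geq 1} p_2\!\left(\frac{n-t^e_i}{2}\right), \] where $t^e_i = \frac{(2i-1)(2i-1+(-1)^i)}{2}$ is the $i$th even triangular number ($0,6,10,28,36,\dots$). If $n$ is odd, then \[ p(n) = \sum_{i\geq 1} p_2\!\left(\frac{n-t^o_i}{2}\right), \] where $t^o_i = \frac{(2i-1)(2i-1-(-1)^i)}{2}$ is the $i$th odd triangular number ($1,3,15,21,\dots$).
   Context: $p(n)$ denotes the number of partitions of $n$. $p_2(n)$ denotes the number of two-color partitions of $n$, i.e. partitions in which each positive integer part may appear in either of two distinguished colors; equivalently $p_2(n) = \sum_{i=0}^n p(i)p(n-i)$, the coefficient of $x^n$ in $\prod_{k\ge1}(1-x^k)^{ -2}$. Both vanish at negative arguments, and $p(0)=p_2(0)=1$. -}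

module Defs where

open import Data.Nat using (ℕ; zero; suc; _+_; _*_; _∸_; _≤_; _≤ᵇ_; _/_)
open import Data.Nat.Base using (_%_)
open import Data.Bool using (Bool; true; false; if_then_else_)

-- number of partitions of n into positive parts each of size at most k
-- (recursion on k: choose the multiplicity j of the part k, j*k ≤ n)
partsAtMost : ℕ → ℕ → ℕ
partsAtMost zero    zero    = 1
partsAtMost (suc n) zero    = 0
partsAtMost n       (suc k) = go n n
  where
  -- go m r: sum over multiplicities j = 0 .. r of partsAtMost (n - j(k+1)) k, valid while j(k+1) ≤ n
  go : ℕ → ℕ → ℕ
  go m zero    = partsAtMost m k
  go m (suc r) = partsAtMost m k + (if suc k ≤ᵇ m then go (m ∸ suc k) r else 0)

p : ℕ → ℕ
p n = partsAtMost n n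

sumTo : ℕ → (ℕ → ℕ) → ℕ
sumTo zero    f = f 0
sumTo (suc n) f = sumTo n f + f (suc n)

sum1to : ℕ → (ℕ → ℕ) → ℕ
sum1to zero    f = 0
sum1to (suc N) f = sum1to N f + f (suc N)

-- p₂(n) = Σ_{i=0}^{n} p(i) p(n-i): number of two-color partitions of n
p₂ : ℕ → ℕ
p₂ n = sumTo n (λ i → p i * p (n ∸ i))

isEven : ℕ → Bool
isEven n = n % 2 ≤ᵇ 0

-- t^e_i = (2i-1)(2i-1+(-1)^i)/2 : i-th even triangular number (i ≥ 1)
--   i even: (2i-1)*i ; i odd: (2i-1)*(i-1)
tE : ℕ → ℕ
tE i = if isEven i then (2 * i ∸ 1) * i else (2 * i ∸ 1) * (i ∸ 1)

-- t^o_i = (2i-1)(2i-1-(-1)^i)/2 : i-th odd triangular number (i ≥ 1)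
--   i even: (2i-1)*(i-1) ; i odd: (2i-1)*i
tO : ℕ → ℕ
tO i = if isEven i then (2 * i ∸ 1) * (i ∸ 1) else (2 * i ∸ 1) * i

-- p₂((n - t)/2), with p₂ vanishing at negative arguments (t > n).
-- (n - t is always even in the theorem since t ≡ n mod 2.)
term : ℕ → ℕ → ℕ
term n t = if t ≤ᵇ n then p₂ ((n ∸ t) / 2) else 0

{-# OPTIONS --safe #-}

-- Comparing coefficients of q^n in 1/(q;q)∞ = ψ(q)/(q²;q²)∞², where ψ(q) = Σₘ q^(m(m+1)/2), gives
-- the theorem: the triangular numbers of the parity of n are exactly the t_i. A finite form of the
-- identity is proved combinatorially. For n < N, p(n) is the coefficient of q^n in the Gaussian
-- binomial [2N choose N]_q, which counts words with N ones and N zeros by inversions. Splitting such a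
-- word into its letters at odd and at even positions gives two words of length N with a and N - a
-- ones; the inversions of the word are twice those of the two halves plus a cross term depending only
-- on a, which runs through the triangular numbers m(m+1)/2, m ≤ N, as a does. Where the total is n,
-- each half has few inversions compared with its numbers of ones and zeros, so the halves are counted
-- by p, and the pairs of them by p₂.
module Submission where

open import Defs
open import Data.Bool using (Bool; true; false; if_then_else_; T)
open import Data.Empty using (⊥-elim)
open import Data.List using (List; []; _∷_; length)
open import Data.Nat using (ℕ; zero; suc; _+_; _*_; _∸_; _≤_; _<_; _≤ᵇ_; _/_; _%_; z≤n; s≤s; _≤?_)
open import Data.Nat.Divisibility using (_∣_; divides; m∣m*n)
open import Data.Nat.DivMod using (m*n/n≡m; m*n%n≡0; [m+kn]%n≡m%n)
open import Data.Nat.Properties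
open import Data.Nat.Tactic.RingSolver using (solve-∀; solve)
open import Data.Product using (_×_; _,_; proj₁; proj₂; ∃-syntax)
open import Data.Sum using (_⊎_; inj₁; inj₂)
open import Data.Unit using (tt)
open import Function using (_∘_)
open import Relation.Binary.PropositionalEquality
  using (_≡_; _≢_; refl; sym; trans; cong; cong₂; subst; subst₂; module ≡-Reasoning)
open import Relation.Nullary using (¬_; yes; no)

if-then-0-cong : ∀ b {x y : ℕ} → (T b → x ≡ y) → (if b then x else 0) ≡ (if b then y else 0)
if-then-0-cong true  x≡y = x≡y tt
if-then-0-cong false _   = refl

if-then-0-false : ∀ b {x : ℕ} → ¬ T b → (if b then x else 0) ≡ 0
if-then-0-false true  ¬b = ⊥-elim (¬b tt)
if-then-0-false false _  = refl

if-then-0-true : ∀ b {x : ℕ} → T b → (if b then x else 0) ≡ x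
if-then-0-true true _ = refl

+-interchange : ∀ a b c d → (a + b) + (c + d) ≡ (a + c) + (b + d)
+-interchange = solve-∀

*-*-zeroʳ-cong : ∀ x y x′ y′ {w} → w ≡ 0 → x * (y * w) ≡ x′ * (y′ * w)
*-*-zeroʳ-cong x y x′ y′ refl =
  trans (cong (x *_) (*-zeroʳ y))
        (trans (*-zeroʳ x) (sym (trans (cong (x′ *_) (*-zeroʳ y′)) (*-zeroʳ x′))))

m≤n+2*m : ∀ n m → m ≤ n + 2 * m
m≤n+2*m n m = ≤-trans (m≤m+n m (m + 0)) (m≤n+m _ n)

double : ℕ → ℕ
double zero    = zero
double (suc n) = suc (suc (double n))

double≡+ : ∀ n → double n ≡ n + n
double≡+ zero    = refl
double≡+ (suc n) = cong suc (trans (cong suc (double≡+ n)) (sym (+-suc n n)))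

even-or-odd : ∀ n → (∃[ y ] n ≡ 2 * y) ⊎ (∃[ y ] n ≡ suc (2 * y))
even-or-odd zero = inj₁ (0 , refl)
even-or-odd (suc n) with even-or-odd n
... | inj₁ (y , refl) = inj₂ (y , refl)
... | inj₂ (y , refl) = inj₁ (suc y , cong suc (sym (+-suc y (y + 0))))

2∤1+2* : ∀ y → ¬ (2 ∣ suc (2 * y))
2∤1+2* y (divides q 1+2y≡q*2) = even≢odd q y (sym (trans 1+2y≡q*2 (*-comm q 2)))


-- Partitions with bounded parts

multiplicitySum : ℕ → ℕ → ℕ → ℕ
multiplicitySum k m zero    = partsAtMost m k
multiplicitySum k m (suc r) =
  partsAtMost m k + (if suc k ≤ᵇ m then multiplicitySum k (m ∸ suc k) r else 0)

multiplicitySum-unique : ∀ k (g : ℕ → ℕ → ℕ) →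
  (∀ m → g m zero ≡ partsAtMost m k) →
  (∀ m r → g m (suc r) ≡ partsAtMost m k + (if suc k ≤ᵇ m then g (m ∸ suc k) r else 0)) →
  ∀ m r → g m r ≡ multiplicitySum k m r
multiplicitySum-unique k g g-zero g-suc m zero    = g-zero m
multiplicitySum-unique k g g-zero g-suc m (suc r) =
  trans (g-suc m r) (cong (partsAtMost m k +_) (if-then-0-cong (suc k ≤ᵇ m) (λ _ →
    multiplicitySum-unique k g g-zero g-suc (m ∸ suc k) r)))

-- partsAtMost unfolds to a local helper of Defs that cannot be named; abstracting its arguments
-- lets multiplicitySum-unique identify it by its defining equations.
partsAtMost-suc≡multiplicitySum : ∀ n k → partsAtMost n (suc k) ≡ multiplicitySum k n n
partsAtMost-suc≡multiplicitySum zero    k = refl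
partsAtMost-suc≡multiplicitySum (suc n) k with suc n
... | m with multiplicitySum-unique k _ (λ _ → refl) (λ _ _ → refl) | n
...   | agree | r with r ∸ k
...     | x = cong (λ y → partsAtMost m k + (if suc k ≤ᵇ m then y else 0)) (agree x r)

multiplicitySum-fuel : ∀ k m r s → m ≤ r → m ≤ s → multiplicitySum k m r ≡ multiplicitySum k m s
multiplicitySum-fuel k m       zero    zero    _       _       = refl
multiplicitySum-fuel k zero    zero    (suc s) _       _       = sym (+-identityʳ _)
multiplicitySum-fuel k zero    (suc r) zero    _       _       = +-identityʳ _
multiplicitySum-fuel k zero    (suc r) (suc s) _       _       = refl
multiplicitySum-fuel k (suc m) (suc r) (suc s) (s≤s m≤r) (s≤s m≤s) =
  cong (partsAtMost (suc m) k +_) (if-then-0-cong (suc k ≤ᵇ suc m) (λ _ →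
    multiplicitySum-fuel k (m ∸ k) r s (≤-trans (m∸n≤m m k) m≤r) (≤-trans (m∸n≤m m k) m≤s)))

partsAtMost-suc : ∀ n k →
  partsAtMost n (suc k) ≡ partsAtMost n k + (if suc k ≤ᵇ n then partsAtMost (n ∸ suc k) (suc k) else 0)
partsAtMost-suc zero    k = sym (+-identityʳ _)
partsAtMost-suc (suc n) k =
  trans (partsAtMost-suc≡multiplicitySum (suc n) k)
        (cong (partsAtMost (suc n) k +_) (if-then-0-cong (suc k ≤ᵇ suc n) (λ _ →
          trans (multiplicitySum-fuel k (n ∸ k) n (n ∸ k) (m∸n≤m n k) ≤-refl)
                (sym (partsAtMost-suc≡multiplicitySum (n ∸ k) k)))))

partsAtMost-zero : ∀ k → partsAtMost 0 k ≡ 1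
partsAtMost-zero zero    = refl
partsAtMost-zero (suc k) = partsAtMost-zero k

partsAtMost-stable : ∀ {n k} → n ≤ k → partsAtMost n k ≡ p n
partsAtMost-stable {k = zero}  z≤n = refl
partsAtMost-stable {n} {suc k} n≤1+k with m≤n⇒m<n∨m≡n n≤1+k
... | inj₂ refl      = refl
... | inj₁ (s≤s n≤k) =
  trans (partsAtMost-suc n k)
        (trans (cong (partsAtMost n k +_) (if-then-0-false (suc k ≤ᵇ n) (λ k<n → <⇒≱ (≤ᵇ⇒≤ (suc k) n k<n) n≤k)))
               (trans (+-identityʳ _) (partsAtMost-stable n≤k)))


-- Finite sums and the Kronecker delta

sumTo-cong : ∀ N {f g : ℕ → ℕ} → (∀ i → i ≤ N → f i ≡ g i) → sumTo N f ≡ sumTo N g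
sumTo-cong zero    f≡g = f≡g 0 z≤n
sumTo-cong (suc N) f≡g =
  cong₂ _+_ (sumTo-cong N (λ i i≤N → f≡g i (m≤n⇒m≤1+n i≤N))) (f≡g (suc N) ≤-refl)

sumTo-zero : ∀ N {f : ℕ → ℕ} → (∀ i → i ≤ N → f i ≡ 0) → sumTo N f ≡ 0
sumTo-zero zero    f≡0 = f≡0 0 z≤n
sumTo-zero (suc N) f≡0 =
  cong₂ _+_ (sumTo-zero N (λ i i≤N → f≡0 i (m≤n⇒m≤1+n i≤N))) (f≡0 (suc N) ≤-refl)

sumTo-distrib-+ : ∀ N (f g : ℕ → ℕ) → sumTo N (λ i → f i + g i) ≡ sumTo N f + sumTo N g
sumTo-distrib-+ zero    f g = refl
sumTo-distrib-+ (suc N) f g =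
  trans (cong (_+ (f (suc N) + g (suc N))) (sumTo-distrib-+ N f g))
        (+-interchange (sumTo N f) (sumTo N g) (f (suc N)) (g (suc N)))

sumTo-*ˡ : ∀ N x (f : ℕ → ℕ) → sumTo N (λ i → x * f i) ≡ x * sumTo N f
sumTo-*ˡ zero    x f = refl
sumTo-*ˡ (suc N) x f = trans (cong (_+ x * f (suc N)) (sumTo-*ˡ N x f)) (sym (*-distribˡ-+ x _ _))

sumTo²-*ˡ : ∀ N M x (f : ℕ → ℕ → ℕ) →
  sumTo N (λ i → sumTo M (λ j → x * f i j)) ≡ x * sumTo N (λ i → sumTo M (f i))
sumTo²-*ˡ N M x f = trans (sumTo-cong N (λ i _ → sumTo-*ˡ M x (f i))) (sumTo-*ˡ N x _)

sumTo-comm : ∀ N M (g : ℕ → ℕ → ℕ) →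
  sumTo N (λ i → sumTo M (g i)) ≡ sumTo M (λ j → sumTo N (λ i → g i j))
sumTo-comm zero    M g = refl
sumTo-comm (suc N) M g =
  trans (cong (_+ sumTo M (g (suc N))) (sumTo-comm N M g))
        (sym (sumTo-distrib-+ M (λ j → sumTo N (λ i → g i j)) (g (suc N))))

sumTo-suc-head : ∀ N (f : ℕ → ℕ) → sumTo (suc N) f ≡ f 0 + sumTo N (f ∘ suc)
sumTo-suc-head zero    f = refl
sumTo-suc-head (suc N) f = trans (cong (_+ f (suc (suc N))) (sumTo-suc-head N f)) (+-assoc (f 0) _ _)

sumTo-truncate : ∀ {K} N (f : ℕ → ℕ) → K ≤ N → (∀ i → K < i → f i ≡ 0) → sumTo N f ≡ sumTo K f
sumTo-truncate N f K≤N f≡0 with m≤n⇒m<n∨m≡n K≤N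
sumTo-truncate N       f _ _   | inj₂ refl = refl
sumTo-truncate (suc N) f _ f≡0 | inj₁ (s≤s K≤N) =
  trans (cong₂ _+_ (sumTo-truncate N f K≤N f≡0) (f≡0 (suc N) (s≤s K≤N))) (+-identityʳ _)

sumTo-in-pairs : ∀ M (f : ℕ → ℕ) →
  sumTo (suc (double M)) f ≡ sum1to (suc M) (λ i → f (double (i ∸ 1)) + f (suc (double (i ∸ 1))))
sumTo-in-pairs zero    f = refl
sumTo-in-pairs (suc M) f =
  trans (+-assoc (sumTo (suc (double M)) f) _ _)
        (cong (_+ (f (double (suc M)) + f (suc (double (suc M))))) (sumTo-in-pairs M f))

sum1to-cong : ∀ N {f g : ℕ → ℕ} → (∀ j → f (suc j) ≡ g (suc j)) → sum1to N f ≡ sum1to N g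
sum1to-cong zero    f≡g = refl
sum1to-cong (suc N) f≡g = cong₂ _+_ (sum1to-cong N f≡g) (f≡g N)

δ : ℕ → ℕ → ℕ
δ zero    zero    = 1
δ zero    (suc b) = 0
δ (suc a) zero    = 0
δ (suc a) (suc b) = δ a b

δ-refl : ∀ a → δ a a ≡ 1
δ-refl zero    = refl
δ-refl (suc a) = δ-refl a

δ-≡⊎≡0 : ∀ a b → a ≡ b ⊎ δ a b ≡ 0
δ-≡⊎≡0 zero    zero    = inj₁ refl
δ-≡⊎≡0 zero    (suc b) = inj₂ refl
δ-≡⊎≡0 (suc a) zero    = inj₂ refl
δ-≡⊎≡0 (suc a) (suc b) with δ-≡⊎≡0 a b
... | inj₁ a≡b = inj₁ (cong suc a≡b)
... | inj₂ δ≡0 = inj₂ δ≡0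

δ-≢ : ∀ {a b} → a ≢ b → δ a b ≡ 0
δ-≢ {a} {b} a≢b with δ-≡⊎≡0 a b
... | inj₁ a≡b = ⊥-elim (a≢b a≡b)
... | inj₂ δ≡0 = δ≡0

δ-cong-⇔ : ∀ {a b c d} → (a ≡ b → c ≡ d) → (c ≡ d → a ≡ b) → δ a b ≡ δ c d
δ-cong-⇔ {a} {b} {c} {d} to from with δ-≡⊎≡0 a b | δ-≡⊎≡0 c d
... | inj₁ refl | _         = trans (δ-refl a) (sym (trans (cong (λ x → δ x d) (to refl)) (δ-refl d)))
... | inj₂ δ≡0  | inj₁ refl = trans (cong (λ x → δ x b) (from refl)) (trans (δ-refl b) (sym (δ-refl c)))
... | inj₂ δ≡0  | inj₂ δ≡0′ = trans δ≡0 (sym δ≡0′)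

δ-+ˡ : ∀ z x i → δ (z + x) i ≡ (if z ≤ᵇ i then δ x (i ∸ z) else 0)
δ-+ˡ zero          x i       = refl
δ-+ˡ (suc z)       x zero    = refl
δ-+ˡ (suc zero)    x (suc i) = refl
δ-+ˡ (suc (suc z)) x (suc i) = δ-+ˡ (suc z) x i

δ-+-∸ : ∀ {a N} b → a ≤ N → δ (a + b) N ≡ δ (N ∸ a) b
δ-+-∸ {a} {N} b a≤N =
  δ-cong-⇔ (λ a+b≡N → trans (cong (_∸ a) (sym a+b≡N)) (m+n∸m≡n a b))
           (λ N∸a≡b → trans (cong (a +_) (sym N∸a≡b)) (m+[n∸m]≡n a≤N))

sumTo-δ : ∀ N {x} (g : ℕ → ℕ) → x ≤ N → sumTo N (λ b → δ x b * g b) ≡ g x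
sumTo-δ N {x} g x≤N =
  trans (sumTo-truncate N _ x≤N (λ b x<b → cong (_* g b) (δ-≢ (<⇒≢ x<b)))) (upTo x)
  where
  upTo : ∀ y → sumTo y (λ b → δ y b * g b) ≡ g y
  upTo zero    = +-identityʳ (g 0)
  upTo (suc y) = cong₂ _+_ (sumTo-zero y (λ b b≤y → cong (_* g b) (δ-≢ (>⇒≢ (s≤s b≤y)))))
                           (trans (cong (_* g (suc y)) (δ-refl y)) (+-identityʳ _))

sumTo-δ-vanishing : ∀ N {x} (g : ℕ → ℕ) → (∀ i → N < i → g i ≡ 0) →
  sumTo N (λ b → δ x b * g b) ≡ g x
sumTo-δ-vanishing N {x} g g≡0 with x ≤? N
... | yes x≤N = sumTo-δ N g x≤N
... | no  x≰N = trans (sumTo-zero N (λ b b≤N → cong (_* g b) (δ-≢ (>⇒≢ (≤-<-trans b≤N (≰⇒> x≰N))))))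
                      (sym (g≡0 x (≰⇒> x≰N)))


-- Binary words and Gaussian binomial coefficients

ones : List Bool → ℕ
ones []          = 0
ones (true  ∷ w) = suc (ones w)
ones (false ∷ w) = ones w

zeros : List Bool → ℕ
zeros []          = 0
zeros (true  ∷ w) = zeros w
zeros (false ∷ w) = suc (zeros w)

inversions : List Bool → ℕ
inversions []          = 0
inversions (true  ∷ w) = zeros w + inversions w
inversions (false ∷ w) = inversions w

ones+zeros≡length : ∀ w → ones w + zeros w ≡ length w
ones+zeros≡length []          = refl
ones+zeros≡length (true  ∷ w) = cong suc (ones+zeros≡length w)
ones+zeros≡length (false ∷ w) = trans (+-suc (ones w) (zeros w)) (cong suc (ones+zeros≡length w))

ones≤length : ∀ w → ones w ≤ length w
ones≤length w = subst (ones w ≤_) (ones+zeros≡length w) (m≤m+n (ones w) (zeros w))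

sumWords : ℕ → (List Bool → ℕ) → ℕ
sumWords zero    f = f []
sumWords (suc L) f = sumWords L (f ∘ (true ∷_)) + sumWords L (f ∘ (false ∷_))

sumWords-cong : ∀ L {f g : List Bool → ℕ} → (∀ w → length w ≡ L → f w ≡ g w) →
  sumWords L f ≡ sumWords L g
sumWords-cong zero    f≡g = f≡g [] refl
sumWords-cong (suc L) f≡g =
  cong₂ _+_ (sumWords-cong L (λ w ∣w∣≡L → f≡g (true ∷ w) (cong suc ∣w∣≡L)))
            (sumWords-cong L (λ w ∣w∣≡L → f≡g (false ∷ w) (cong suc ∣w∣≡L)))

sumWords-zero : ∀ L {f : List Bool → ℕ} → (∀ w → length w ≡ L → f w ≡ 0) → sumWords L f ≡ 0
sumWords-zero zero    f≡0 = f≡0 [] refl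
sumWords-zero (suc L) f≡0 =
  cong₂ _+_ (sumWords-zero L (λ w ∣w∣≡L → f≡0 (true ∷ w) (cong suc ∣w∣≡L)))
            (sumWords-zero L (λ w ∣w∣≡L → f≡0 (false ∷ w) (cong suc ∣w∣≡L)))

sumWords-distrib-+ : ∀ L (f g : List Bool → ℕ) →
  sumWords L (λ w → f w + g w) ≡ sumWords L f + sumWords L g
sumWords-distrib-+ zero    f g = refl
sumWords-distrib-+ (suc L) f g =
  trans (cong₂ _+_ (sumWords-distrib-+ L _ _) (sumWords-distrib-+ L _ _))
        (+-interchange (sumWords L (f ∘ (true ∷_))) (sumWords L (g ∘ (true ∷_)))
                       (sumWords L (f ∘ (false ∷_))) (sumWords L (g ∘ (false ∷_))))

sumWords-*ʳ : ∀ L (f : List Bool → ℕ) x → sumWords L (λ w → f w * x) ≡ sumWords L f * x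
sumWords-*ʳ zero    f x = refl
sumWords-*ʳ (suc L) f x =
  trans (cong₂ _+_ (sumWords-*ʳ L (f ∘ (true ∷_)) x) (sumWords-*ʳ L (f ∘ (false ∷_)) x))
        (sym (*-distribʳ-+ x (sumWords L (f ∘ (true ∷_))) (sumWords L (f ∘ (false ∷_)))))

sumWords-sumTo : ∀ L M (g : List Bool → ℕ → ℕ) →
  sumWords L (λ w → sumTo M (g w)) ≡ sumTo M (λ i → sumWords L (λ w → g w i))
sumWords-sumTo zero    M g = refl
sumWords-sumTo (suc L) M g =
  trans (cong₂ _+_ (sumWords-sumTo L M _) (sumWords-sumTo L M _))
        (sym (sumTo-distrib-+ M (λ i → sumWords L (λ w → g (true ∷ w) i))
                                (λ i → sumWords L (λ w → g (false ∷ w) i))))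

-- the coefficient of q^i in the Gaussian binomial coefficient [L choose m]_q
gaussian : ℕ → ℕ → ℕ → ℕ
gaussian L m i = sumWords L (λ w → δ (ones w) m * δ (inversions w) i)

gaussian-pascal : ∀ a b i →
  gaussian (suc a + b) (suc a) i
    ≡ (if b ≤ᵇ i then gaussian (a + b) a (i ∸ b) else 0) + gaussian (a + b) (suc a) i
gaussian-pascal a b i =
  cong (_+ gaussian (a + b) (suc a) i) (trans (sumWords-cong (a + b) leading-one) (pull-if (b ≤ᵇ i)))
  where
  leading-one : ∀ w → length w ≡ a + b →
    δ (ones w) a * δ (zeros w + inversions w) i
      ≡ δ (ones w) a * (if b ≤ᵇ i then δ (inversions w) (i ∸ b) else 0)
  leading-one w ∣w∣≡a+b with δ-≡⊎≡0 (ones w) a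
  ... | inj₂ δ≡0 rewrite δ≡0 = refl
  ... | inj₁ refl rewrite +-cancelˡ-≡ (ones w) (zeros w) b (trans (ones+zeros≡length w) ∣w∣≡a+b) =
    cong (δ (ones w) (ones w) *_) (δ-+ˡ b (inversions w) i)
  pull-if : ∀ c → sumWords (a + b) (λ w → δ (ones w) a * (if c then δ (inversions w) (i ∸ b) else 0))
                ≡ (if c then gaussian (a + b) a (i ∸ b) else 0)
  pull-if true  = refl
  pull-if false = sumWords-zero (a + b) (λ w _ → *-zeroʳ (δ (ones w) a))

gaussian-no-ones : ∀ L i → gaussian L 0 i ≡ δ 0 i
gaussian-no-ones zero    i = +-identityʳ _
gaussian-no-ones (suc L) i = cong₂ _+_ (sumWords-zero L (λ _ _ → refl)) (gaussian-no-ones L i)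

gaussian-too-many-ones : ∀ {L m} i → L < m → gaussian L m i ≡ 0
gaussian-too-many-ones {L} {m} i L<m = sumWords-zero L (λ w ∣w∣≡L →
  cong (_* δ (inversions w) i) (δ-≢ (λ ones≡m → <⇒≱ L<m (subst₂ _≤_ ones≡m ∣w∣≡L (ones≤length w)))))

gaussian-all-ones : ∀ a i → gaussian (a + 0) a i ≡ δ 0 i
gaussian-all-ones zero    i = +-identityʳ _
gaussian-all-ones (suc a) i =
  trans (gaussian-pascal a 0 i)
        (trans (cong₂ _+_ (gaussian-all-ones a i) (gaussian-too-many-ones i (s≤s (≤-reflexive (+-identityʳ a)))))
               (+-identityʳ _))

partsAtMost-no-parts : ∀ i → partsAtMost i 0 ≡ δ 0 i
partsAtMost-no-parts zero    = refl
partsAtMost-no-parts (suc i) = refl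

-- Counting the zeros after each one maps a word with m ones and l zeros to a partition
-- of its inversion count into at most m parts of size at most l; for i ≤ m the bound on
-- the number of parts is vacuous.
gaussian≡partsAtMost : ∀ l m i → i ≤ m → gaussian (m + l) m i ≡ partsAtMost i l
gaussian≡partsAtMost zero    m       i    _     = trans (gaussian-all-ones m i) (sym (partsAtMost-no-parts i))
gaussian≡partsAtMost (suc l) zero    zero _     =
  trans (gaussian-no-ones (suc l) 0) (sym (partsAtMost-zero (suc l)))
gaussian≡partsAtMost (suc l) (suc m) i    i≤1+m = begin
  gaussian (suc m + suc l) (suc m) i
    ≡⟨ gaussian-pascal m (suc l) i ⟩
  (if suc l ≤ᵇ i then gaussian (m + suc l) m (i ∸ suc l) else 0) + gaussian (m + suc l) (suc m) i
    ≡⟨ cong₂ _+_ (if-then-0-cong (suc l ≤ᵇ i) (λ _ → gaussian≡partsAtMost (suc l) m (i ∸ suc l) i∸1+l≤m))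
                 (trans (cong (λ L → gaussian L (suc m) i) (+-suc m l))
                        (gaussian≡partsAtMost l (suc m) i i≤1+m)) ⟩
  (if suc l ≤ᵇ i then partsAtMost (i ∸ suc l) (suc l) else 0) + partsAtMost i l
    ≡⟨ +-comm _ (partsAtMost i l) ⟩
  partsAtMost i l + (if suc l ≤ᵇ i then partsAtMost (i ∸ suc l) (suc l) else 0)
    ≡⟨ partsAtMost-suc i l ⟨
  partsAtMost i (suc l) ∎
  where
  open ≡-Reasoning
  i∸1+l≤m : i ∸ suc l ≤ m
  i∸1+l≤m = ≤-trans (∸-monoˡ-≤ (suc l) i≤1+m) (m∸n≤m m l)

gaussian≡p : ∀ {a b i} → i ≤ a → i ≤ b → gaussian (a + b) a i ≡ p i
gaussian≡p {a} {b} {i} i≤a i≤b = trans (gaussian≡partsAtMost b a i i≤a) (partsAtMost-stable i≤b)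

sumWords-by-statistics : ∀ L n (h : ℕ → ℕ → ℕ) → (∀ a i → n < i → h a i ≡ 0) →
  sumWords L (λ w → h (ones w) (inversions w)) ≡ sumTo L (λ a → sumTo n (λ i → gaussian L a i * h a i))
sumWords-by-statistics L n h h≡0 = begin
  sumWords L (λ w → h (ones w) (inversions w))
    ≡⟨ sumWords-cong L (λ w ∣w∣≡L → sym (sifted w ∣w∣≡L)) ⟩
  sumWords L (λ w → sumTo L (λ a → sumTo n (λ i → indicator w a i * h a i)))
    ≡⟨ sumWords-sumTo L L _ ⟩
  sumTo L (λ a → sumWords L (λ w → sumTo n (λ i → indicator w a i * h a i)))
    ≡⟨ sumTo-cong L (λ a _ → sumWords-sumTo L n _) ⟩
  sumTo L (λ a → sumTo n (λ i → sumWords L (λ w → indicator w a i * h a i)))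
    ≡⟨ sumTo-cong L (λ a _ → sumTo-cong n (λ i _ → sumWords-*ʳ L (λ w → indicator w a i) (h a i))) ⟩
  sumTo L (λ a → sumTo n (λ i → gaussian L a i * h a i)) ∎
  where
  open ≡-Reasoning
  indicator : List Bool → ℕ → ℕ → ℕ
  indicator w a i = δ (ones w) a * δ (inversions w) i
  sifted : ∀ w → length w ≡ L →
    sumTo L (λ a → sumTo n (λ i → indicator w a i * h a i)) ≡ h (ones w) (inversions w)
  sifted w ∣w∣≡L = begin
    sumTo L (λ a → sumTo n (λ i → indicator w a i * h a i))
      ≡⟨ sumTo-cong L (λ a _ → trans (sumTo-cong n (λ i _ → *-assoc (δ (ones w) a) _ _))
                                     (sumTo-*ˡ n (δ (ones w) a) _)) ⟩
    sumTo L (λ a → δ (ones w) a * sumTo n (λ i → δ (inversions w) i * h a i))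
      ≡⟨ sumTo-δ L _ (subst (ones w ≤_) ∣w∣≡L (ones≤length w)) ⟩
    sumTo n (λ i → δ (inversions w) i * h (ones w) i)
      ≡⟨ sumTo-δ-vanishing n (h (ones w)) (h≡0 (ones w)) ⟩
    h (ones w) (inversions w) ∎

sumWordPairs-by-statistics : ∀ L n (h : ℕ → ℕ → ℕ → ℕ → ℕ) →
  (∀ a i b j → n < i → h a i b j ≡ 0) → (∀ a i b j → n < j → h a i b j ≡ 0) →
  sumWords L (λ u → sumWords L (λ v → h (ones u) (inversions u) (ones v) (inversions v)))
    ≡ sumTo L (λ a → sumTo n (λ i → sumTo L (λ b → sumTo n (λ j →
        gaussian L a i * (gaussian L b j * h a i b j)))))
sumWordPairs-by-statistics L n h h≡0ˡ h≡0ʳ = begin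
  sumWords L (λ u → sumWords L (λ v → h (ones u) (inversions u) (ones v) (inversions v)))
    ≡⟨ sumWords-cong L (λ u _ →
         sumWords-by-statistics L n (h (ones u) (inversions u)) (h≡0ʳ (ones u) (inversions u))) ⟩
  sumWords L (λ u → inner (ones u) (inversions u))
    ≡⟨ sumWords-by-statistics L n inner inner≡0 ⟩
  sumTo L (λ a → sumTo n (λ i → gaussian L a i * inner a i))
    ≡⟨ sumTo-cong L (λ a _ → sumTo-cong n (λ i _ → sym (sumTo²-*ˡ L n (gaussian L a i) _))) ⟩
  sumTo L (λ a → sumTo n (λ i → sumTo L (λ b → sumTo n (λ j →
    gaussian L a i * (gaussian L b j * h a i b j))))) ∎
  where
  open ≡-Reasoning
  inner : ℕ → ℕ → ℕ
  inner a i = sumTo L (λ b → sumTo n (λ j → gaussian L b j * h a i b j))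
  inner≡0 : ∀ a i → n < i → inner a i ≡ 0
  inner≡0 a i n<i = sumTo-zero L (λ b _ → sumTo-zero n (λ j _ →
    trans (cong (gaussian L b j *_) (h≡0ˡ a i b j n<i)) (*-zeroʳ (gaussian L b j))))


-- Interleaving two words

interleave : List Bool → List Bool → List Bool
interleave (x ∷ u) (y ∷ v) = x ∷ y ∷ interleave u v
interleave _       _       = []

sumWords-double : ∀ N f →
  sumWords (double N) f ≡ sumWords N (λ u → sumWords N (λ v → f (interleave u v)))
sumWords-double zero    f = refl
sumWords-double (suc N) f = begin
  (sumWords (double N) (f ∘ (true ∷_) ∘ (true ∷_)) + sumWords (double N) (f ∘ (true ∷_) ∘ (false ∷_)))
    + (sumWords (double N) (f ∘ (false ∷_) ∘ (true ∷_)) + sumWords (double N) (f ∘ (false ∷_) ∘ (false ∷_)))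
    ≡⟨ cong₂ _+_ (cong₂ _+_ (sumWords-double N _) (sumWords-double N _))
                 (cong₂ _+_ (sumWords-double N _) (sumWords-double N _)) ⟩
  (S true true + S true false) + (S false true + S false false)
    ≡⟨ cong₂ _+_ (sumWords-distrib-+ N _ _) (sumWords-distrib-+ N _ _) ⟨
  sumWords (suc N) (λ u → sumWords (suc N) (λ v → f (interleave u v))) ∎
  where
  open ≡-Reasoning
  S : Bool → Bool → ℕ
  S x y = sumWords N (λ u → sumWords N (λ v → f (x ∷ y ∷ interleave u v)))

ones-interleave : ∀ u v → length u ≡ length v → ones (interleave u v) ≡ ones u + ones v
ones-interleave []          []          _ = refl
ones-interleave (true  ∷ u) (true  ∷ v) e rewrite ones-interleave u v (suc-injective e) =
  cong suc (sym (+-suc (ones u) (ones v)))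
ones-interleave (true  ∷ u) (false ∷ v) e rewrite ones-interleave u v (suc-injective e) = refl
ones-interleave (false ∷ u) (true  ∷ v) e rewrite ones-interleave u v (suc-injective e) =
  sym (+-suc (ones u) (ones v))
ones-interleave (false ∷ u) (false ∷ v) e = ones-interleave u v (suc-injective e)

zeros-interleave : ∀ u v → length u ≡ length v → zeros (interleave u v) ≡ zeros u + zeros v
zeros-interleave []          []          _ = refl
zeros-interleave (true  ∷ u) (true  ∷ v) e = zeros-interleave u v (suc-injective e)
zeros-interleave (true  ∷ u) (false ∷ v) e rewrite zeros-interleave u v (suc-injective e) =
  sym (+-suc (zeros u) (zeros v))
zeros-interleave (false ∷ u) (true  ∷ v) e rewrite zeros-interleave u v (suc-injective e) = refl
zeros-interleave (false ∷ u) (false ∷ v) e rewrite zeros-interleave u v (suc-injective e) =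
  cong suc (sym (+-suc (zeros u) (zeros v)))

equal-ones+zeros : ∀ u v → length u ≡ length v → ones u + zeros u ≡ ones v + zeros v
equal-ones+zeros u v e = trans (ones+zeros≡length u) (trans e (sym (ones+zeros≡length v)))

triangular : ℕ → ℕ
triangular zero    = 0
triangular (suc n) = suc n + triangular n

triangular-≥ : ∀ b → b ≤ triangular b
triangular-≥ zero    = z≤n
triangular-≥ (suc b) = m≤m+n (suc b) (triangular b)

-- The inversions between the letters of u and those of v in interleave u v, for u and v
-- of equal length with a and b ones; for a ≥ b this is triangular (a - b), otherwise
-- triangular (b - a - 1).
cross : ℕ → ℕ → ℕ
cross (suc a) (suc b) = cross a b
cross a       zero    = triangular a
cross zero    (suc b) = triangular b

cross-zero-left : ∀ b → cross 0 b + b ≡ triangular b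
cross-zero-left zero    = refl
cross-zero-left (suc b) = +-comm (triangular b) (suc b)

cross-suc-left : ∀ a b → cross (suc a) b + b ≡ cross a b + suc a
cross-suc-left zero    zero    = refl
cross-suc-left (suc a) zero    = trans (+-identityʳ _) (+-comm (suc (suc a)) (triangular (suc a)))
cross-suc-left zero    (suc b) =
  trans (+-suc (cross 0 b) b) (trans (cong suc (cross-zero-left b)) (+-comm 1 (triangular b)))
cross-suc-left (suc a) (suc b) =
  trans (+-suc (cross (suc a) b) b) (trans (cong suc (cross-suc-left a b)) (sym (+-suc (cross a b) (suc a))))

cross-suc-right : ∀ a b → cross a (suc b) + a ≡ cross a b + b
cross-suc-right zero          b       = trans (+-identityʳ _) (sym (cross-zero-left b))
cross-suc-right (suc zero)    zero    = refl
cross-suc-right (suc (suc a)) zero    = trans (+-comm (triangular (suc a)) (suc (suc a))) (sym (+-identityʳ _))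
cross-suc-right (suc a)       (suc b) =
  trans (+-suc (cross a (suc b)) a) (trans (cong suc (cross-suc-right a b)) (sym (+-suc (cross a b) b)))

a≤b+cross : ∀ a b → a ≤ b + cross a b
a≤b+cross zero    b       = z≤n
a≤b+cross (suc a) zero    = m≤m+n (suc a) (triangular a)
a≤b+cross (suc a) (suc b) = s≤s (a≤b+cross a b)

b≤1+a+cross : ∀ a b → b ≤ suc (a + cross a b)
b≤1+a+cross zero    zero    = z≤n
b≤1+a+cross zero    (suc b) = s≤s (triangular-≥ b)
b≤1+a+cross (suc a) zero    = z≤n
b≤1+a+cross (suc a) (suc b) = s≤s (b≤1+a+cross a b)

C+2K<a+b⇒K≤a×K≤b : ∀ {a b C K} → a ≤ b + C → b ≤ suc (a + C) → C + 2 * K < a + b → K ≤ a × K ≤ b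
C+2K<a+b⇒K≤a×K≤b {a} {b} {C} {K} a≤b+C b≤1+a+C C+2K<a+b = K≤a , K≤b
  where
  open ≤-Reasoning
  K≤a : K ≤ a
  K≤a with K ≤? a
  ... | yes K≤a = K≤a
  ... | no  K≰a = ⊥-elim (<⇒≱ C+2K<a+b (begin
    a + b                  ≤⟨ +-monoʳ-≤ a b≤1+a+C ⟩
    a + suc (a + C)        ≤⟨ n≤1+n _ ⟩
    suc (a + suc (a + C))  ≡⟨ solve (a ∷ C ∷ []) ⟩
    C + 2 * suc a          ≤⟨ +-monoʳ-≤ C (*-monoʳ-≤ 2 (≰⇒> K≰a)) ⟩
    C + 2 * K              ∎))
  K≤b : K ≤ b
  K≤b with K ≤? b
  ... | yes K≤b = K≤b
  ... | no  K≰b = ⊥-elim (<⇒≱ C+2K<a+b (begin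
    a + b                  ≤⟨ +-monoˡ-≤ b a≤b+C ⟩
    b + C + b              ≡⟨ solve (b ∷ C ∷ []) ⟩
    C + 2 * b              ≤⟨ +-monoʳ-≤ C (*-monoʳ-≤ 2 (<⇒≤ (≰⇒> K≰b))) ⟩
    C + 2 * K              ∎))

interleave-inversions-one-zero : ∀ a b zu zv iu iv {C C′} → a + zu ≡ b + zv → C′ + b ≡ C + suc a →
  suc (zu + zv) + (C + 2 * (iu + iv)) ≡ C′ + 2 * ((zu + iu) + iv)
interleave-inversions-one-zero a b zu zv iu iv {C} {C′} a+zu≡b+zv C′+b≡C+1+a =
  +-cancelʳ-≡ b _ _ (begin
    suc (zu + zv) + (C + 2 * (iu + iv)) + b ≡⟨ solve (zu ∷ zv ∷ C ∷ iu ∷ iv ∷ b ∷ []) ⟩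
    C + suc (b + zv) + zu + 2 * (iu + iv)   ≡⟨ cong (λ x → C + suc x + zu + 2 * (iu + iv)) a+zu≡b+zv ⟨
    C + suc (a + zu) + zu + 2 * (iu + iv)   ≡⟨ solve (C ∷ a ∷ zu ∷ iu ∷ iv ∷ []) ⟩
    (C + suc a) + 2 * ((zu + iu) + iv)      ≡⟨ cong (_+ 2 * ((zu + iu) + iv)) C′+b≡C+1+a ⟨
    (C′ + b) + 2 * ((zu + iu) + iv)         ≡⟨ solve (C′ ∷ b ∷ zu ∷ iu ∷ iv ∷ []) ⟩
    C′ + 2 * ((zu + iu) + iv) + b           ∎)
  where open ≡-Reasoning

interleave-inversions-zero-one : ∀ a b zu zv iu iv {C C′} → a + zu ≡ b + zv → C′ + a ≡ C + b →
  (zu + zv) + (C + 2 * (iu + iv)) ≡ C′ + 2 * (iu + (zv + iv))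
interleave-inversions-zero-one a b zu zv iu iv {C} {C′} a+zu≡b+zv C′+a≡C+b =
  +-cancelʳ-≡ a _ _ (begin
    (zu + zv) + (C + 2 * (iu + iv)) + a ≡⟨ solve (zu ∷ zv ∷ C ∷ iu ∷ iv ∷ a ∷ []) ⟩
    C + (a + zu) + zv + 2 * (iu + iv)   ≡⟨ cong (λ x → C + x + zv + 2 * (iu + iv)) a+zu≡b+zv ⟩
    C + (b + zv) + zv + 2 * (iu + iv)   ≡⟨ solve (C ∷ b ∷ zv ∷ iu ∷ iv ∷ []) ⟩
    (C + b) + 2 * (iu + (zv + iv))      ≡⟨ cong (_+ 2 * (iu + (zv + iv))) C′+a≡C+b ⟨
    (C′ + a) + 2 * (iu + (zv + iv))     ≡⟨ solve (C′ ∷ a ∷ iu ∷ zv ∷ iv ∷ []) ⟩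
    C′ + 2 * (iu + (zv + iv)) + a       ∎)
  where open ≡-Reasoning

inversions-interleave : ∀ u v → length u ≡ length v →
  inversions (interleave u v) ≡ cross (ones u) (ones v) + 2 * (inversions u + inversions v)
inversions-interleave []          []          _ = refl
inversions-interleave (true  ∷ u) (true  ∷ v) e
  rewrite zeros-interleave u v (suc-injective e) | inversions-interleave u v (suc-injective e) =
  both-ones (zeros u) (zeros v) (inversions u) (inversions v) (cross (ones u) (ones v))
  where
  both-ones : ∀ zu zv iu iv C →
    (zu + zv) + ((zu + zv) + (C + 2 * (iu + iv))) ≡ C + 2 * ((zu + iu) + (zv + iv))
  both-ones = solve-∀
inversions-interleave (true  ∷ u) (false ∷ v) e
  rewrite zeros-interleave u v (suc-injective e) | inversions-interleave u v (suc-injective e) =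
  interleave-inversions-one-zero (ones u) (ones v) (zeros u) (zeros v) (inversions u) (inversions v)
    (equal-ones+zeros u v (suc-injective e)) (cross-suc-left (ones u) (ones v))
inversions-interleave (false ∷ u) (true  ∷ v) e
  rewrite zeros-interleave u v (suc-injective e) | inversions-interleave u v (suc-injective e) =
  interleave-inversions-zero-one (ones u) (ones v) (zeros u) (zeros v) (inversions u) (inversions v)
    (equal-ones+zeros u v (suc-injective e)) (cross-suc-right (ones u) (ones v))
inversions-interleave (false ∷ u) (false ∷ v) e = inversions-interleave u v (suc-injective e)


-- The central Gaussian binomial coefficient

-- 1 if two words of equal length with a, b ones and i, j inversions interleave to a word with
-- N ones and n inversions, and 0 otherwise
interleavingWeight : ℕ → ℕ → ℕ → ℕ → ℕ → ℕ → ℕ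
interleavingWeight N n a i b j = δ (a + b) N * δ (cross a b + 2 * (i + j)) n

central≡interleavings : ∀ N n →
  gaussian (double N) N n
    ≡ sumWords N (λ u → sumWords N (λ v →
        interleavingWeight N n (ones u) (inversions u) (ones v) (inversions v)))
central≡interleavings N n =
  trans (sumWords-double N _) (sumWords-cong N (λ u ∣u∣≡N → sumWords-cong N (λ v ∣v∣≡N →
    let ∣u∣≡∣v∣ = trans ∣u∣≡N (sym ∣v∣≡N) in
    cong₂ (λ x y → δ x N * δ y n) (ones-interleave u v ∣u∣≡∣v∣) (inversions-interleave u v ∣u∣≡∣v∣))))

interleavingWeight-vanishes : ∀ N n a i b j → n < i + j → interleavingWeight N n a i b j ≡ 0
interleavingWeight-vanishes N n a i b j n<i+j =
  trans (cong (δ (a + b) N *_) (δ-≢ (λ e → <⇒≱ n<i+j (subst (i + j ≤_) e (m≤n+2*m (cross a b) (i + j))))))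
        (*-zeroʳ (δ (a + b) N))

-- Where the weight is nonzero, cross a b + 2 (i + j) = n < N = a + b forces i + j ≤ a, b,
-- and there both Gaussian coefficients have stabilised to p.
gaussian≡p-on-support : ∀ {N n} → n < N → ∀ a i b j →
  gaussian N a i * (gaussian N b j * interleavingWeight N n a i b j)
    ≡ p i * (p j * interleavingWeight N n a i b j)
gaussian≡p-on-support {N} {n} n<N a i b j
  with δ-≡⊎≡0 (a + b) N | δ-≡⊎≡0 (cross a b + 2 * (i + j)) n
... | inj₁ refl | inj₁ refl =
  cong₂ (λ x y → x * (y * interleavingWeight N n a i b j))
        (gaussian≡p (≤-trans (m≤m+n i j) i+j≤a) (≤-trans (m≤m+n i j) i+j≤b))
        (trans (cong (λ L → gaussian L b j) (+-comm a b))
               (gaussian≡p (≤-trans (m≤n+m j i) i+j≤b) (≤-trans (m≤n+m j i) i+j≤a)))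
  where
  bounds : i + j ≤ a × i + j ≤ b
  bounds = C+2K<a+b⇒K≤a×K≤b (a≤b+cross a b) (b≤1+a+cross a b) n<N
  i+j≤a : i + j ≤ a
  i+j≤a = proj₁ bounds
  i+j≤b : i + j ≤ b
  i+j≤b = proj₂ bounds
... | inj₂ δ≡0 | _        = *-*-zeroʳ-cong (gaussian N a i) (gaussian N b j) (p i) (p j)
  (cong (_* δ (cross a b + 2 * (i + j)) n) δ≡0)
... | inj₁ _   | inj₂ δ≡0 = *-*-zeroʳ-cong (gaussian N a i) (gaussian N b j) (p i) (p j)
  (trans (cong (δ (a + b) N *_) δ≡0) (*-zeroʳ (δ (a + b) N)))

-- the coefficient of q^n in q^t P(q²)², where P(q) = Σ p(k) q^k
pairCount : ℕ → ℕ → ℕ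
pairCount n t = sumTo n (λ i → sumTo n (λ j → p i * (p j * δ (t + 2 * (i + j)) n)))

sumTo-interleavingWeight : ∀ {N a} n → a ≤ N →
  sumTo n (λ i → sumTo N (λ b → sumTo n (λ j → p i * (p j * interleavingWeight N n a i b j))))
    ≡ pairCount n (cross a (N ∸ a))
sumTo-interleavingWeight {N} {a} n a≤N = begin
  sumTo n (λ i → sumTo N (λ b → sumTo n (λ j → p i * (p j * interleavingWeight N n a i b j))))
    ≡⟨ sumTo-comm n N _ ⟩
  sumTo N (λ b → sumTo n (λ i → sumTo n (λ j → p i * (p j * interleavingWeight N n a i b j))))
    ≡⟨ sumTo-cong N (λ b _ →
         trans (sumTo-cong n (λ i _ → sumTo-cong n (λ j _ → rearrange (p i) (p j) (δ (a + b) N) _)))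
               (sumTo²-*ˡ n n (δ (a + b) N) _)) ⟩
  sumTo N (λ b → δ (a + b) N * pairCount n (cross a b))
    ≡⟨ sumTo-cong N (λ b _ → cong (_* pairCount n (cross a b)) (δ-+-∸ b a≤N)) ⟩
  sumTo N (λ b → δ (N ∸ a) b * pairCount n (cross a b))
    ≡⟨ sumTo-δ N (λ b → pairCount n (cross a b)) (m∸n≤m N a) ⟩
  pairCount n (cross a (N ∸ a)) ∎
  where
  open ≡-Reasoning
  rearrange : ∀ x y d e → x * (y * (d * e)) ≡ d * (x * (y * e))
  rearrange = solve-∀

sumTo-cross-complement : ∀ N (G : ℕ → ℕ) →
  sumTo N (λ a → G (cross a (N ∸ a))) ≡ sumTo N (G ∘ triangular)
sumTo-cross-complement zero          G = refl
sumTo-cross-complement (suc zero)    G = refl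
sumTo-cross-complement (suc (suc N)) G = begin
  sumTo (suc (suc N)) (λ a → G (cross a (suc (suc N) ∸ a)))
    ≡⟨ sumTo-suc-head (suc N) _ ⟩
  G (triangular (suc N))
    + (sumTo N (λ a → G (cross (suc a) (suc N ∸ a))) + G (cross (suc (suc N)) (N ∸ N)))
    ≡⟨ cong₂ (λ x y → G (triangular (suc N)) + (x + y)) middle last ⟩
  G (triangular (suc N)) + (sumTo N (G ∘ triangular) + G (triangular (suc (suc N))))
    ≡⟨ +-assoc (G (triangular (suc N))) _ _ ⟨
  G (triangular (suc N)) + sumTo N (G ∘ triangular) + G (triangular (suc (suc N)))
    ≡⟨ cong (_+ G (triangular (suc (suc N)))) (+-comm (G (triangular (suc N))) _) ⟩
  sumTo (suc (suc N)) (G ∘ triangular) ∎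
  where
  open ≡-Reasoning
  middle : sumTo N (λ a → G (cross (suc a) (suc N ∸ a))) ≡ sumTo N (G ∘ triangular)
  middle = trans (sumTo-cong N (λ a a≤N → cong (λ t → G (cross (suc a) t)) (+-∸-assoc 1 a≤N)))
                 (sumTo-cross-complement N G)
  last : G (cross (suc (suc N)) (N ∸ N)) ≡ G (triangular (suc (suc N)))
  last = cong (G ∘ cross (suc (suc N))) (n∸n≡0 N)

p≡sumTo-pairCount : ∀ {n N} → n < N → p n ≡ sumTo N (λ m → pairCount n (triangular m))
p≡sumTo-pairCount {n} {N} n<N = begin
  p n
    ≡⟨ gaussian≡p (<⇒≤ n<N) (<⇒≤ n<N) ⟨
  gaussian (N + N) N n
    ≡⟨ cong (λ L → gaussian L N n) (double≡+ N) ⟨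
  gaussian (double N) N n
    ≡⟨ central≡interleavings N n ⟩
  sumWords N (λ u → sumWords N (λ v → weight (ones u) (inversions u) (ones v) (inversions v)))
    ≡⟨ sumWordPairs-by-statistics N n weight
         (λ a i b j n<i → interleavingWeight-vanishes N n a i b j (<-≤-trans n<i (m≤m+n i j)))
         (λ a i b j n<j → interleavingWeight-vanishes N n a i b j (<-≤-trans n<j (m≤n+m j i))) ⟩
  sumTo N (λ a → sumTo n (λ i → sumTo N (λ b → sumTo n (λ j →
    gaussian N a i * (gaussian N b j * weight a i b j)))))
    ≡⟨ sumTo-cong N (λ a _ → sumTo-cong n (λ i _ → sumTo-cong N (λ b _ → sumTo-cong n (λ j _ →
         gaussian≡p-on-support n<N a i b j)))) ⟩
  sumTo N (λ a → sumTo n (λ i → sumTo N (λ b → sumTo n (λ j → p i * (p j * weight a i b j)))))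
    ≡⟨ sumTo-cong N (λ a a≤N → sumTo-interleavingWeight n a≤N) ⟩
  sumTo N (λ a → pairCount n (cross a (N ∸ a)))
    ≡⟨ sumTo-cross-complement N (pairCount n) ⟩
  sumTo N (λ m → pairCount n (triangular m)) ∎
  where
  open ≡-Reasoning
  weight : ℕ → ℕ → ℕ → ℕ → ℕ
  weight = interleavingWeight N n


-- Extracting two-colour partition numbers

pairCount-solvable : ∀ n t K → t + 2 * K ≡ n → pairCount n t ≡ p₂ K
pairCount-solvable n t K t+2K≡n = begin
  pairCount n t
    ≡⟨ sumTo-cong n (λ i _ → trans (sumTo-cong n (λ j _ → cong (λ d → p i * (p j * d)) (δ-halve i j)))
                                   (sumTo-*ˡ n (p i) _)) ⟩
  sumTo n (λ i → p i * complement i)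
    ≡⟨ sumTo-truncate n _ K≤n (λ i K<i → trans (cong (p i *_) (complement-large K<i)) (*-zeroʳ (p i))) ⟩
  sumTo K (λ i → p i * complement i)
    ≡⟨ sumTo-cong K (λ i i≤K → cong (p i *_) (complement-small i≤K)) ⟩
  p₂ K ∎
  where
  open ≡-Reasoning
  K≤n : K ≤ n
  K≤n = subst (K ≤_) t+2K≡n (≤-trans (m≤m+n K (K + 0)) (m≤n+m (2 * K) t))
  δ-halve : ∀ i j → δ (t + 2 * (i + j)) n ≡ δ (i + j) K
  δ-halve i j = δ-cong-⇔ (λ e → *-cancelˡ-≡ (i + j) K 2 (+-cancelˡ-≡ t _ _ (trans e (sym t+2K≡n))))
                         (λ e → trans (cong (λ x → t + 2 * x) e) t+2K≡n)
  complement : ℕ → ℕ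
  complement i = sumTo n (λ j → p j * δ (i + j) K)
  complement-large : ∀ {i} → K < i → complement i ≡ 0
  complement-large {i} K<i = sumTo-zero n (λ j _ →
    trans (cong (p j *_) (δ-≢ (λ i+j≡K → <⇒≱ K<i (subst (i ≤_) i+j≡K (m≤m+n i j))))) (*-zeroʳ (p j)))
  complement-small : ∀ {i} → i ≤ K → complement i ≡ p (K ∸ i)
  complement-small {i} i≤K =
    trans (sumTo-cong n (λ j _ → trans (*-comm (p j) _) (cong (_* p j) (δ-+-∸ j i≤K))))
          (sumTo-δ n p (≤-trans (m∸n≤m K i) K≤n))

pairCount-unsolvable : ∀ n t → (∀ K → t + 2 * K ≢ n) → pairCount n t ≡ 0
pairCount-unsolvable n t unsolvable = sumTo-zero n (λ i _ → sumTo-zero n (λ j _ →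
  *-*-zeroʳ-cong (p i) (p j) 0 0 (δ-≢ (unsolvable (i + j)))))

pairCount-large : ∀ n t → n < t → pairCount n t ≡ 0
pairCount-large n t n<t = pairCount-unsolvable n t (λ K t+2K≡n → <⇒≱ n<t (subst (t ≤_) t+2K≡n (m≤m+n t _)))

term-solvable : ∀ n t K → t + 2 * K ≡ n → term n t ≡ p₂ K
term-solvable .(t + 2 * K) t K refl =
  trans (if-then-0-true (t ≤ᵇ t + 2 * K) (≤⇒≤ᵇ (m≤m+n t _)))
        (cong p₂ (trans (cong (_/ 2) (trans (m+n∸m≡n t (2 * K)) (*-comm 2 K))) (m*n/n≡m K 2)))

term-large : ∀ n t → n < t → term n t ≡ 0
term-large n t n<t = if-then-0-false (t ≤ᵇ n) (λ t≤n → <⇒≱ n<t (≤ᵇ⇒≤ t n t≤n))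

pairCount≡term : ∀ r x y → pairCount (r + 2 * y) (r + 2 * x) ≡ term (r + 2 * y) (r + 2 * x)
pairCount≡term r x y with x ≤? y
... | yes x≤y = trans (pairCount-solvable (r + 2 * y) (r + 2 * x) (y ∸ x) halves)
                      (sym (term-solvable (r + 2 * y) (r + 2 * x) (y ∸ x) halves))
  where
  halves : r + 2 * x + 2 * (y ∸ x) ≡ r + 2 * y
  halves = trans (+-assoc r _ _)
                 (cong (r +_) (trans (sym (*-distribˡ-+ 2 x (y ∸ x))) (cong (2 *_) (m+[n∸m]≡n x≤y))))
... | no  x≰y = trans (pairCount-large (r + 2 * y) (r + 2 * x) r+2y<r+2x)
                      (sym (term-large (r + 2 * y) (r + 2 * x) r+2y<r+2x))
  where
  r+2y<r+2x : r + 2 * y < r + 2 * x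
  r+2y<r+2x = +-monoʳ-< r (*-monoʳ-< 2 (≰⇒> x≰y))

pairCount-odd-in-even : ∀ x y → pairCount (2 * y) (suc (2 * x)) ≡ 0
pairCount-odd-in-even x y = pairCount-unsolvable (2 * y) (suc (2 * x)) (λ K e →
  even≢odd y (x + K) (sym (trans (cong suc (*-distribˡ-+ 2 x K)) e)))

pairCount-even-in-odd : ∀ x y → pairCount (suc (2 * y)) (2 * x) ≡ 0
pairCount-even-in-odd x y = pairCount-unsolvable (suc (2 * y)) (2 * x) (λ K e →
  even≢odd (x + K) y (trans (*-distribˡ-+ 2 x K) e))


-- Triangular numbers of even and odd index

triangular-double : ∀ j → triangular (double j) ≡ j * suc (2 * j)
triangular-double zero    = refl
triangular-double (suc j) rewrite triangular-double j | double≡+ j = step j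
  where
  step : ∀ j → suc (suc (j + j)) + (suc (j + j) + j * suc (2 * j)) ≡ suc j * suc (2 * suc j)
  step = solve-∀

triangular-suc-double : ∀ j → triangular (suc (double j)) ≡ suc (2 * j) * suc j
triangular-suc-double j rewrite triangular-double j | double≡+ j = step j
  where
  step : ∀ j → suc (j + j) + j * suc (2 * j) ≡ suc (2 * j) * suc j
  step = solve-∀

[2i∸1]*i≡triangular : ∀ j → (2 * suc j ∸ 1) * suc j ≡ triangular (suc (double j))
[2i∸1]*i≡triangular j = trans (cong (_* suc j) (+-suc j (j + 0))) (sym (triangular-suc-double j))

[2i∸1]*[i∸1]≡triangular : ∀ j → (2 * suc j ∸ 1) * j ≡ triangular (double j)
[2i∸1]*[i∸1]≡triangular j =
  trans (cong (_* j) (+-suc j (j + 0))) (trans (*-comm (suc (2 * j)) j) (sym (triangular-double j)))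

isEven-2* : ∀ y → isEven (2 * y) ≡ true
isEven-2* y = cong (_≤ᵇ 0) (trans (cong (_% 2) (*-comm 2 y)) (m*n%n≡0 y 2))

isEven-2+2* : ∀ y → isEven (suc (suc (2 * y))) ≡ true
isEven-2+2* y = trans (cong isEven (cong suc (sym (+-suc y (y + 0))))) (isEven-2* (suc y))

isEven-1+2* : ∀ y → isEven (suc (2 * y)) ≡ false
isEven-1+2* y = cong (_≤ᵇ 0) (trans (cong (λ z → suc z % 2) (*-comm 2 y)) ([m+kn]%n≡m%n 1 y 2))

tE-at-odd : ∀ h → tE (suc (2 * h)) ≡ triangular (double (2 * h))
tE-at-odd h rewrite isEven-1+2* h = [2i∸1]*[i∸1]≡triangular (2 * h)

tO-at-odd : ∀ h → tO (suc (2 * h)) ≡ triangular (suc (double (2 * h)))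
tO-at-odd h rewrite isEven-1+2* h = [2i∸1]*i≡triangular (2 * h)

tE-at-even : ∀ h → tE (suc (suc (2 * h))) ≡ triangular (suc (double (suc (2 * h))))
tE-at-even h rewrite isEven-2+2* h = [2i∸1]*i≡triangular (suc (2 * h))

tO-at-even : ∀ h → tO (suc (suc (2 * h))) ≡ triangular (double (suc (2 * h)))
tO-at-even h rewrite isEven-2+2* h = [2i∸1]*[i∸1]≡triangular (suc (2 * h))

triangular-pair≡tE+tO : ∀ (G : ℕ → ℕ) j →
  G (triangular (double j)) + G (triangular (suc (double j))) ≡ G (tE (suc j)) + G (tO (suc j))
triangular-pair≡tE+tO G j with even-or-odd j
... | inj₁ (h , refl) rewrite tE-at-odd h  | tO-at-odd h  = refl
... | inj₂ (h , refl) rewrite tE-at-even h | tO-at-even h = +-comm (G (triangular (double (suc (2 * h))))) _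

tE-even×tO-odd : ∀ j → (∃[ x ] tE (suc j) ≡ 2 * x) × (∃[ x ] tO (suc j) ≡ suc (2 * x))
tE-even×tO-odd j with even-or-odd j
... | inj₁ (h , refl) =
  (h * suc (2 * (2 * h)) , trans (tE-at-odd h) (trans (triangular-double (2 * h)) (*-assoc 2 h _))) ,
  (h * (4 * h + 3) , trans (tO-at-odd h) (trans (triangular-suc-double (2 * h)) (odd*odd h)))
  where
  odd*odd : ∀ h → suc (2 * (2 * h)) * suc (2 * h) ≡ suc (2 * (h * (4 * h + 3)))
  odd*odd = solve-∀
... | inj₂ (h , refl) =
  ((4 * h + 3) * (h + 1) , trans (tE-at-even h) (trans (triangular-suc-double (suc (2 * h))) (odd*even h))) ,
  (4 * h * h + 5 * h + 1 , trans (tO-at-even h) (trans (triangular-double (suc (2 * h))) (odd*odd h)))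
  where
  odd*even : ∀ h → suc (2 * suc (2 * h)) * suc (suc (2 * h)) ≡ 2 * ((4 * h + 3) * (h + 1))
  odd*even = solve-∀
  odd*odd : ∀ h → suc (2 * h) * suc (2 * suc (2 * h)) ≡ suc (2 * (4 * h * h + 5 * h + 1))
  odd*odd = solve-∀

p≡sum1to-pairCount : ∀ {n M} → n ≤ M →
  p n ≡ sum1to (suc M) (λ i → pairCount n (tE i) + pairCount n (tO i))
p≡sum1to-pairCount {n} {M} n≤M = begin
  p n
    ≡⟨ p≡sumTo-pairCount (s≤s (≤-trans n≤M (subst (M ≤_) (sym (double≡+ M)) (m≤m+n M M)))) ⟩
  sumTo (suc (double M)) (pairCount n ∘ triangular)
    ≡⟨ sumTo-in-pairs M (pairCount n ∘ triangular) ⟩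
  sum1to (suc M) (λ i → pairCount n (triangular (double (i ∸ 1)))
                         + pairCount n (triangular (suc (double (i ∸ 1)))))
    ≡⟨ sum1to-cong (suc M) (triangular-pair≡tE+tO (pairCount n)) ⟩
  sum1to (suc M) (λ i → pairCount n (tE i) + pairCount n (tO i)) ∎
  where open ≡-Reasoning

p-even : ∀ y N → suc (2 * y) ≤ N → p (2 * y) ≡ sum1to N (λ i → term (2 * y) (tE i))
p-even y (suc M) (s≤s 2y≤M) = trans (p≡sum1to-pairCount 2y≤M) (sum1to-cong (suc M) only-tE)
  where
  only-tE : ∀ j →
    pairCount (2 * y) (tE (suc j)) + pairCount (2 * y) (tO (suc j)) ≡ term (2 * y) (tE (suc j))
  only-tE j with tE-even×tO-odd j
  ... | (x , tE≡) , (x′ , tO≡) rewrite tE≡ | tO≡ =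
    trans (cong₂ _+_ (pairCount≡term 0 x y) (pairCount-odd-in-even x′ y)) (+-identityʳ _)

p-odd : ∀ y N → suc (suc (2 * y)) ≤ N → p (suc (2 * y)) ≡ sum1to N (λ i → term (suc (2 * y)) (tO i))
p-odd y (suc M) (s≤s 2y+1≤M) = trans (p≡sum1to-pairCount 2y+1≤M) (sum1to-cong (suc M) only-tO)
  where
  only-tO : ∀ j →
    pairCount (suc (2 * y)) (tE (suc j)) + pairCount (suc (2 * y)) (tO (suc j))
      ≡ term (suc (2 * y)) (tO (suc j))
  only-tO j with tE-even×tO-odd j
  ... | (x , tE≡) , (x′ , tO≡) rewrite tE≡ | tO≡ =
    cong₂ _+_ (pairCount-even-in-odd x y) (pairCount≡term 1 x′ y)

theorem5 : (n : ℕ) →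
    ((2 ∣ n) → (N : ℕ) → suc n ≤ N → p n ≡ sum1to N (λ i → term n (tE i)))
    × ((¬ (2 ∣ n)) → (N : ℕ) → suc n ≤ N → p n ≡ sum1to N (λ i → term n (tO i)))
theorem5 n with even-or-odd n
... | inj₁ (y , refl) = (λ _ → p-even y) , (λ 2∤2y → ⊥-elim (2∤2y (m∣m*n y)))
... | inj₂ (y , refl) = (λ 2∣1+2y → ⊥-elim (2∤1+2* y 2∣1+2y)) , (λ _ → p-odd y)
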